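{- In the theory EZF described in the context, let $X,Y\in\text{EZF}$. Then $X\subseteq Y$ if and only if $P(X)\subseteq P(Y)$.
   Context: The theory EZF: the language of ZF augmented with a binary relation symbol $\in_1$. $\mathcal{V}$ is the von Neumann universe; its members are Zermelo sets; $\mathcal{V}^*=\mathcal{V}\setminus\{\emptyset\}$. Axioms: ZF minus Power Set, relativized to $\mathcal V$; Extensionality: for $A,B\in\mathcal V$, if $\forall S\in\mathcal V(S\in_1 A\Leftrightarrow S\in_1 B)$ then $A=B$; Powerset: for every object $X$ there is $Y\in\mathcal V$ with $\forall A\in\mathcal V(A\in_1 X\Leftrightarrow A\in Y)$, written $P(X)$; Inverse powerset: for every $Y\in\mathcal V^*$ there is an object $X$ with $\forall A\in\mathcal V(A\in Y\Leftrightarrow A\in_1 X)$, written $P^{ -1}(Y)$; Subset assignment: for $X,A\in\mathcal V$, $\forall x(x\in A\Rightarrow x\in X)\Leftrightarrow A\in_1 X$. EZF is the class of Zermelo sets together with all $P^{ -1}(X)$, $X\in\mathcal V^*$. Extended subset relation: $X\subseteq Y$ iff either ($X,Y\in\mathcal V$ and every $A\in\mathcal V$ with $A\in X$ has $A\in Y$) or (at least one of $X,Y$ is not in $\mathcal V$ and every $A\in\mathcal V$ with $A\in_1 X$ has $A\in_1 Y$). -}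

module Defs where

open import Data.Product using (Σ; _×_; _,_; ∃)
open import Data.Sum using (_⊎_)
open import Relation.Nullary using (¬_; Dec)
open import Relation.Binary.PropositionalEquality using (_≡_)
open import Function.Bundles using (_⇔_)

-- Obj      : the objects of the universe of discourse
-- _∈_      : the ZF membership relation
-- _∈₁_     : the new binary relation symbol ∈₁
-- V        : the class 𝒱 (von Neumann universe; its members are the Zermelo sets)
record EZFModel : Set₁ where
  field
    Obj  : Set
    _∈_  : Obj → Obj → Set
    _∈₁_ : Obj → Obj → Set
    V    : Obj → Set

    -- the ambient logic is classical: membership in 𝒱 is decidable
    V-dec : ∀ x → Dec (V x)

    V-trans : ∀ A x → V A → x ∈ A → V x

    ext∈ : ∀ A B → V A → V B → (∀ x → V x → (x ∈ A ⇔ x ∈ B)) → A ≡ B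
    empty : Σ Obj λ e → V e × (∀ x → V x → ¬ (x ∈ e))
    pairing : ∀ a b → V a → V b →
      Σ Obj λ c → V c × (∀ x → V x → (x ∈ c ⇔ (x ≡ a ⊎ x ≡ b)))
    union : ∀ a → V a →
      Σ Obj λ u → V u × (∀ x → V x → (x ∈ u ⇔ Σ Obj λ y → V y × x ∈ y × y ∈ a))
    infinity : Σ Obj λ w → V w
      × (Σ Obj λ e → V e × e ∈ w × (∀ x → V x → ¬ (x ∈ e)))
      × (∀ x → V x → x ∈ w →
           Σ Obj λ s → V s × s ∈ w × (∀ z → V z → (z ∈ s ⇔ (z ∈ x ⊎ z ≡ x))))
    foundation : ∀ a → V a → (Σ Obj λ x → V x × x ∈ a) →
      Σ Obj λ y → V y × y ∈ a × (∀ z → V z → z ∈ y → ¬ (z ∈ a))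

    ext₁ : ∀ A B → V A → V B → (∀ S → V S → (S ∈₁ A ⇔ S ∈₁ B)) → A ≡ B
    powerset : ∀ X → Σ Obj λ Y → V Y × (∀ A → V A → (A ∈₁ X ⇔ A ∈ Y))
    inv-powerset : ∀ Y → V Y → ¬ (∀ z → ¬ (z ∈ Y)) →
      Σ Obj λ X → (∀ A → V A → (A ∈ Y ⇔ A ∈₁ X))
    subset-assignment : ∀ X A → V X → V A →
      ((∀ x → x ∈ A → x ∈ X) ⇔ A ∈₁ X)

module _ (M : EZFModel) where
  open EZFModel M

  V* : Obj → Set
  V* Y = V Y × ¬ (∀ x → ¬ (x ∈ Y))

  IsPowerset : Obj → Obj → Set
  IsPowerset X Y = V Y × (∀ A → V A → (A ∈₁ X ⇔ A ∈ Y))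

  IsInvPowerset : Obj → Obj → Set
  IsInvPowerset Y X = ∀ A → V A → (A ∈ Y ⇔ A ∈₁ X)

  InEZF : Obj → Set
  InEZF X = V X ⊎ (Σ Obj λ Y → V* Y × IsInvPowerset Y X)

  _⊆_ : Obj → Obj → Set
  X ⊆ Y = (V X × V Y × (∀ A → V A → A ∈ X → A ∈ Y))
        ⊎ ((¬ (V X) ⊎ ¬ (V Y)) × (∀ A → V A → A ∈₁ X → A ∈₁ Y))

-- Both sides reduce to the same condition: every Zermelo set that is ∈₁ X is ∈₁ Y.
-- For P(X) ⊆ P(Y) this is the powerset axiom, as P(X), P(Y) are Zermelo sets.
-- For X ⊆ Y it is the definition when X or Y is not a Zermelo set; otherwise
-- subset assignment gives one direction, and applied to the singleton {A} the other.
module Submission where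

open import Defs
open import Data.Product using (Σ; _×_; _,_)
open import Data.Sum using (inj₁; inj₂)
open import Data.Empty using (⊥-elim)
open import Relation.Nullary using (yes; no)
open import Relation.Binary.PropositionalEquality using (refl)
open import Function.Bundles using (_⇔_; mk⇔; Equivalence)
import Function.Properties.Equivalence as ⇔

module _ (M : EZFModel) where
  open EZFModel M
  open Equivalence

  _⊆∈_ : Obj → Obj → Set
  X ⊆∈ Y = ∀ A → V A → A ∈ X → A ∈ Y

  _⊆₁_ : Obj → Obj → Set
  X ⊆₁ Y = ∀ A → V A → A ∈₁ X → A ∈₁ Y

  ⊆∈⇒⊆₁ : ∀ X Y → V X → V Y → X ⊆∈ Y → X ⊆₁ Y
  ⊆∈⇒⊆₁ X Y vX vY X⊆Y A vA A∈₁X =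
    to (subset-assignment Y A vY vA) λ x x∈A →
      X⊆Y x (V-trans A x vA x∈A) (from (subset-assignment X A vX vA) A∈₁X x x∈A)

  singleton-∈₁ : ∀ X A → V X → V A → A ∈ X → Σ Obj λ s → V s × A ∈ s × s ∈₁ X
  singleton-∈₁ X A vX vA A∈X with pairing A A vA vA
  ... | s , vs , s-members =
    s , vs , from (s-members A vA) (inj₁ refl) , to (subset-assignment X s vX vs) s⊆X
    where
    s⊆X : ∀ x → x ∈ s → x ∈ X
    s⊆X x x∈s with to (s-members x (V-trans s x vs x∈s)) x∈s
    ... | inj₁ refl = A∈X
    ... | inj₂ refl = A∈X

  ⊆₁⇒⊆∈ : ∀ X Y → V X → V Y → X ⊆₁ Y → X ⊆∈ Y
  ⊆₁⇒⊆∈ X Y vX vY X⊆Y A vA A∈X with singleton-∈₁ X A vX vA A∈X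
  ... | s , vs , A∈s , s∈₁X =
    from (subset-assignment Y s vY vs) (X⊆Y s vs s∈₁X) A A∈s

  ⊆⇔⊆₁ : ∀ X Y → _⊆_ M X Y ⇔ X ⊆₁ Y
  ⊆⇔⊆₁ X Y = mk⇔ ⊆⇒⊆₁ ⊆₁⇒⊆
    where
    ⊆⇒⊆₁ : _⊆_ M X Y → X ⊆₁ Y
    ⊆⇒⊆₁ (inj₁ (vX , vY , X⊆Y)) = ⊆∈⇒⊆₁ X Y vX vY X⊆Y
    ⊆⇒⊆₁ (inj₂ (_ , X⊆Y))       = X⊆Y
    ⊆₁⇒⊆ : X ⊆₁ Y → _⊆_ M X Y
    ⊆₁⇒⊆ X⊆Y with V-dec X | V-dec Y
    ... | no ¬vX | _      = inj₂ (inj₁ ¬vX , X⊆Y)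
    ... | yes _  | no ¬vY = inj₂ (inj₂ ¬vY , X⊆Y)
    ... | yes vX | yes vY = inj₁ (vX , vY , ⊆₁⇒⊆∈ X Y vX vY X⊆Y)

  ⊆⇔⊆∈ : ∀ X Y → V X → V Y → _⊆_ M X Y ⇔ X ⊆∈ Y
  ⊆⇔⊆∈ X Y vX vY = mk⇔ ⊆⇒⊆∈ (λ X⊆Y → inj₁ (vX , vY , X⊆Y))
    where
    ⊆⇒⊆∈ : _⊆_ M X Y → X ⊆∈ Y
    ⊆⇒⊆∈ (inj₁ (_ , _ , X⊆Y))     = X⊆Y
    ⊆⇒⊆∈ (inj₂ (inj₁ ¬vX , _)) = ⊥-elim (¬vX vX)
    ⊆⇒⊆∈ (inj₂ (inj₂ ¬vY , _)) = ⊥-elim (¬vY vY)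

  powerset-⊆∈⇔⊆₁ : ∀ X Y PX PY → IsPowerset M X PX → IsPowerset M Y PY →
    PX ⊆∈ PY ⇔ X ⊆₁ Y
  powerset-⊆∈⇔⊆₁ X Y PX PY (_ , PX≡) (_ , PY≡) = mk⇔
    (λ PX⊆PY A vA A∈₁X → from (PY≡ A vA) (PX⊆PY A vA (to (PX≡ A vA) A∈₁X)))
    (λ X⊆Y A vA A∈PX → to (PY≡ A vA) (X⊆Y A vA (from (PX≡ A vA) A∈PX)))

proposition7 : (M : EZFModel) → (X Y PX PY : EZFModel.Obj M) →
    InEZF M X → InEZF M Y →
    IsPowerset M X PX → IsPowerset M Y PY →
    (_⊆_ M X Y ⇔ _⊆_ M PX PY)
proposition7 M X Y PX PY _ _ PX-pow@(vPX , _) PY-pow@(vPY , _) =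
  ⇔.trans (⊆⇔⊆₁ M X Y)
    (⇔.trans (⇔.sym (powerset-⊆∈⇔⊆₁ M X Y PX PY PX-pow PY-pow))
      (⇔.sym (⊆⇔⊆∈ M PX PY vPX vPY)))
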